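{- Let $n\ge 9$ and let $F$ be a facet of $\Delta_3(W_n)$ such that either $F^c=\{x,\,x+1 \bmod n,\,x+4\bmod n\}$ or $F^c=\{x,\,x+3\bmod n,\,x+4\bmod n\}$ for some $x\in V(W_n)$, where $F^c=V(W_n)\setminus F$. Then $F$ is not a spanning facet for the order $\prec$ on the facets of $\Delta_3(W_n)$.
   Context: $W_n$ ($n\ge 9$) is the graph on $\{0,\dots,n-1\}$ with $i$ adjacent to $i\pm1$ and $i\pm 2 \pmod n$. $\Delta_3(W_n)$ is the simplicial complex whose facets are the $(n-3)$-subsets $F\subseteq V(W_n)$ such that the induced subgraph of $W_n$ on $V(W_n)\setminus F$ is disconnected. Let $m=(n+1)/2$ if $n$ is odd and $m=n/2$ if $n$ is even. Define $\alpha_t = m+(-1)^{t-1}\lfloor t/2\rfloor \pmod n$ for $1\le t\le n$. For $(n-3)$-subsets $\tau$, let $\mathcal T_s$ be the set of those $\tau$ with $\alpha_s\in\tau^c$ and $\alpha_1,\dots,\alpha_{s-1}\notin\tau^c$. For $\tau\in\mathcal T_s$ write $\tau^c=\{\alpha_s\}\sqcup\{s_1,s_2\}$ with $s_1<s_2$. For facets $F\in\mathcal T_s$, $F'\in\mathcal T_t$ with $F^c=\{\alpha_s\}\sqcup\{s_1,s_2\}$, $F'^c=\{\alpha_t\}\sqcup\{s_1',s_2'\}$, set $F\ll F'$ iff $s<t$, or $s=t$ and ($s_1<s_1'$, or $s_1=s_1'$ and $s_2<s_2'$). Let $\mathcal D$ be the set of facets $F\in\mathcal T_s$ (some $s$)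 with: $F^c=\{\alpha_s,\alpha_s-3,\alpha_s+1\}$ and $\alpha_s=m+1$; or $F^c=\{\alpha_s,\alpha_s-1,\alpha_s+3\}$ and $\alpha_s=m-1$; or $F^c=\{\alpha_s,\alpha_s-4,\alpha_s-3\}$ and $\alpha_s=m+1$; or $F^c=\{\alpha_s,\alpha_s+3,\alpha_s+4\}$ and $\alpha_s\in\{m-1,\dots,n-6\}$. For distinct facets $F\in\mathcal T_s$, $F'\in\mathcal T_t$, define $F\prec F'$ iff one of: (i) $F,F'\notin\mathcal D$ and $F\ll F'$; (ii) $F\in\mathcal D$, $F'\notin\mathcal D$ and $s<t$; (iii) $F\notin\mathcal D$, $F'\in\mathcal D$ and $s\le t$; (iv) $F,F'\in\mathcal D$ and $F\ll F'$; otherwise $F'\prec F$. A facet $F$ is a spanning facet for $\prec$ if for each $\lambda\in F$ there is a facet $\tilde F\prec F$ with $\tilde F\cap F=F\setminus\{\lambda\}$. -}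

module Defs where

open import Data.Nat using (ℕ; zero; suc; _+_; _∸_; _≤_; _<_; NonZero)
open import Data.Nat.DivMod using (_mod_; _/_; _%_)
open import Data.Fin using (Fin; toℕ)
import Data.Fin as Fin
open import Data.Fin.Subset using (Subset; _∈_; _∉_; ∁; ⁅_⁆; _∪_; _∩_; ∣_∣; _-_)
open import Data.Bool using (if_then_else_)
open import Data.Nat using (_≡ᵇ_)
open import Data.Product using (Σ; ∃; _×_; _,_)
open import Data.Sum using (_⊎_)
open import Relation.Binary.PropositionalEquality using (_≡_; _≢_)
open import Relation.Nullary using (¬_)

module _ (n : ℕ) .{{nz : NonZero n}} where

  -- vertices of W_n are Fin n ≅ {0,…,n-1};  x ⊕ k = x + k mod n
  _⊕_ : Fin n → ℕ → Fin n
  x ⊕ k = (toℕ x + k) mod n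

  -- x ⊖ k = x - k mod n   (used only for k ≤ n)
  _⊖_ : Fin n → ℕ → Fin n
  x ⊖ k = x ⊕ (n ∸ k)

  Adj : Fin n → Fin n → Set
  Adj i j = i ≢ j × (j ≡ i ⊕ 1 ⊎ j ≡ i ⊕ 2 ⊎ i ≡ j ⊕ 1 ⊎ i ≡ j ⊕ 2)

  data Reach (S : Subset n) : Fin n → Fin n → Set where
    here : ∀ {u} → Reach S u u
    step : ∀ {u w v} → Adj u w → w ∈ S → Reach S w v → Reach S u v

  Disconnected : Subset n → Set
  Disconnected S = ∃ λ u → ∃ λ v → u ∈ S × v ∈ S × ¬ Reach S u v

  -- facets of Δ₃(W_n): (n-3)-subsets F with W_n[V ∖ F] disconnected
  IsFacet : Subset n → Set
  IsFacet F = ∣ F ∣ ≡ n ∸ 3 × Disconnected (∁ F)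

  m : ℕ
  m = if (n % 2 ≡ᵇ 0) then n / 2 else (n + 1) / 2

  -- α_t = m + (-1)^(t-1) ⌊t/2⌋ mod n
  α : ℕ → Fin n
  α t = if (t % 2 ≡ᵇ 0) then (m + (n ∸ (t / 2))) mod n else (m + t / 2) mod n

  InT : ℕ → Subset n → Set
  InT s τ = 1 ≤ s × s ≤ n × α s ∈ ∁ τ
            × (∀ t → 1 ≤ t → t < s → α t ∉ ∁ τ)

  Decomp : Subset n → ℕ → Fin n → Fin n → Set
  Decomp τ s s₁ s₂ = InT s τ × s₁ Fin.< s₂ × s₁ ≢ α s × s₂ ≢ α s
                     × ∁ τ ≡ ⁅ α s ⁆ ∪ ⁅ s₁ ⁆ ∪ ⁅ s₂ ⁆

  _≪_ : Subset n → Subset n → Set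
  F ≪ F' = ∃ λ s → ∃ λ s₁ → ∃ λ s₂ → ∃ λ t → ∃ λ t₁ → ∃ λ t₂ →
           Decomp F s s₁ s₂ × Decomp F' t t₁ t₂ ×
           (s < t ⊎ (s ≡ t × (s₁ Fin.< t₁ ⊎ (s₁ ≡ t₁ × s₂ Fin.< t₂))))

  InD : Subset n → Set
  InD F = IsFacet F × ∃ λ s → InT s F ×
          ( (∁ F ≡ ⁅ α s ⁆ ∪ ⁅ α s ⊖ 3 ⁆ ∪ ⁅ α s ⊕ 1 ⁆ × toℕ (α s) ≡ m + 1)
          ⊎ (∁ F ≡ ⁅ α s ⁆ ∪ ⁅ α s ⊖ 1 ⁆ ∪ ⁅ α s ⊕ 3 ⁆ × toℕ (α s) ≡ m ∸ 1)
          ⊎ (∁ F ≡ ⁅ α s ⁆ ∪ ⁅ α s ⊖ 4 ⁆ ∪ ⁅ α s ⊖ 3 ⁆ × toℕ (α s) ≡ m + 1)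
          ⊎ (∁ F ≡ ⁅ α s ⁆ ∪ ⁅ α s ⊕ 3 ⁆ ∪ ⁅ α s ⊕ 4 ⁆
               × m ∸ 1 ≤ toℕ (α s) × toℕ (α s) ≤ n ∸ 6))

  _≺_ : Subset n → Subset n → Set
  F ≺ F' = IsFacet F × IsFacet F' × F ≢ F' ×
           ( (¬ InD F × ¬ InD F' × F ≪ F')
           ⊎ (InD F × ¬ InD F' × ∃ λ s → ∃ λ t → InT s F × InT t F' × s < t)
           ⊎ (¬ InD F × InD F' × ∃ λ s → ∃ λ t → InT s F × InT t F' × s ≤ t)
           ⊎ (InD F × InD F' × F ≪ F'))

  Spanning : Subset n → Set
  Spanning F = ∀ λ' → λ' ∈ F → ∃ λ F̃ → F̃ ≺ F × F̃ ∩ F ≡ F - λ'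

{-# OPTIONS --safe #-}
-- The vertex l = x + 2 is adjacent in W_n to every vertex of Fᶜ.  A facet F̃ with
-- F̃ ∩ F = F ∖ {l} has l ∈ F̃ᶜ ⊆ Fᶜ ∪ {l}, so W_n[F̃ᶜ] is a star centred at l and hence
-- connected, contradicting that F̃ is a facet.
module Submission where

open import Defs
open import Data.Nat using (ℕ; _+_; _*_; _≤_; _<_; NonZero; z≤n; s≤s)
open import Data.Nat.Properties using (+-assoc; +-cancelˡ-≡; ≤-trans; <-trans; n<1+n)
open import Data.Nat.DivMod using (_%_; _/_; m≡m%n+[m/n]*n; %-distribˡ-+; m%n%n≡m%n)
open import Data.Nat.Divisibility using (divides; >⇒∤)
open import Data.Fin using (Fin; zero; suc; toℕ)
open import Data.Fin.Properties using (toℕ-fromℕ<; toℕ-injective; _≟_)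
open import Data.Fin.Subset using (Subset; ∁; ⁅_⁆; _∪_; _∩_; _∈_; _∉_; _-_)
open import Data.Fin.Subset.Properties
  using (x∈p∪q⁻; x∈⁅y⁆⇒x≡y; x∈p∩q⁺; x∈p∩q⁻; x∈p∧x≢y⇒x∈p-y; x∉∁p⇒x∈p; x∉p⇒x∈∁p; x∈∁p⇒x∉p)
open import Data.Vec using (_∷_)
open import Data.Vec.Base using (there)
open import Data.Product using (∃; _×_; _,_; proj₁)
open import Data.Sum using (_⊎_; inj₁; inj₂)
open import Function using (_∘_)
open import Relation.Binary.PropositionalEquality
  using (_≡_; _≢_; refl; sym; trans; cong; subst; module ≡-Reasoning)
open import Relation.Nullary using (¬_; yes; no)

x∉p-x : ∀ {k} (p : Subset k) x → x ∉ p - x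
x∉p-x (_ ∷ p) zero    ()
x∉p-x (_ ∷ p) (suc x) (there x∈p-x) = x∉p-x p x x∈p-x

∈-triple-elim : ∀ {k} {P : Fin k → Set} {a b c} → P a → P b → P c →
                ∀ {w} → w ∈ ⁅ a ⁆ ∪ ⁅ b ⁆ ∪ ⁅ c ⁆ → P w
∈-triple-elim {a = a} {b} {c} pa pb pc w∈ with x∈p∪q⁻ ⁅ a ⁆ (⁅ b ⁆ ∪ ⁅ c ⁆) w∈
... | inj₁ w∈a = subst _ (sym (x∈⁅y⁆⇒x≡y a w∈a)) pa
... | inj₂ w∈bc with x∈p∪q⁻ ⁅ b ⁆ ⁅ c ⁆ w∈bc
...   | inj₁ w∈b = subst _ (sym (x∈⁅y⁆⇒x≡y b w∈b)) pb
...   | inj₂ w∈c = subst _ (sym (x∈⁅y⁆⇒x≡y c w∈c)) pc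

module _ (n : ℕ) .{{_ : NonZero n}} where

  private
    _⊞_ : Fin n → ℕ → Fin n
    _⊞_ = _⊕_ n

  toℕ-⊕ : ∀ x k → toℕ (x ⊞ k) ≡ (toℕ x + k) % n
  toℕ-⊕ x k = toℕ-fromℕ< _

  [m%n+k]%n≡[m+k]%n : ∀ a k → (a % n + k) % n ≡ (a + k) % n
  [m%n+k]%n≡[m+k]%n a k = begin
    (a % n + k) % n           ≡⟨ %-distribˡ-+ (a % n) k n ⟩
    (a % n % n + k % n) % n   ≡⟨ cong (λ r → (r + k % n) % n) (m%n%n≡m%n a n) ⟩
    (a % n + k % n) % n       ≡⟨ sym (%-distribˡ-+ a k n) ⟩
    (a + k) % n               ∎
    where open ≡-Reasoning

  ⊕-assoc : ∀ x a b → (x ⊞ a) ⊞ b ≡ x ⊞ (a + b)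
  ⊕-assoc x a b = toℕ-injective (begin
    toℕ ((x ⊞ a) ⊞ b)         ≡⟨ toℕ-⊕ (x ⊞ a) b ⟩
    (toℕ (x ⊞ a) + b) % n     ≡⟨ cong (λ r → (r + b) % n) (toℕ-⊕ x a) ⟩
    ((toℕ x + a) % n + b) % n ≡⟨ [m%n+k]%n≡[m+k]%n (toℕ x + a) b ⟩
    (toℕ x + a + b) % n       ≡⟨ cong (_% n) (+-assoc (toℕ x) a b) ⟩
    (toℕ x + (a + b)) % n     ≡⟨ sym (toℕ-⊕ x (a + b)) ⟩
    toℕ (x ⊞ (a + b))         ∎)
    where open ≡-Reasoning

  -- x + d ≡ x (mod n) would make n divide d.
  x⊕d≢x : ∀ x d .{{_ : NonZero d}} → d < n → x ⊞ d ≢ x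
  x⊕d≢x x d d<n x⊕d≡x = >⇒∤ d<n (divides ((X + d) / n) d≡qn)
    where
    X = toℕ x
    d≡qn : d ≡ (X + d) / n * n
    d≡qn = +-cancelˡ-≡ X d _ (begin
      X + d                         ≡⟨ m≡m%n+[m/n]*n (X + d) n ⟩
      (X + d) % n + (X + d) / n * n
        ≡⟨ cong (λ r → r + (X + d) / n * n) (trans (sym (toℕ-⊕ x d)) (cong toℕ x⊕d≡x)) ⟩
      X + (X + d) / n * n           ∎)
      where open ≡-Reasoning

  Adj-sym : ∀ {i j} → Adj n i j → Adj n j i
  Adj-sym (i≢j , inj₁ j≡i+1)               = i≢j ∘ sym , inj₂ (inj₂ (inj₁ j≡i+1))
  Adj-sym (i≢j , inj₂ (inj₁ j≡i+2))        = i≢j ∘ sym , inj₂ (inj₂ (inj₂ j≡i+2))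
  Adj-sym (i≢j , inj₂ (inj₂ (inj₁ i≡j+1))) = i≢j ∘ sym , inj₁ i≡j+1
  Adj-sym (i≢j , inj₂ (inj₂ (inj₂ i≡j+2))) = i≢j ∘ sym , inj₂ (inj₁ i≡j+2)

  Adj-⊕1 : 1 < n → ∀ x → Adj n x (x ⊞ 1)
  Adj-⊕1 1<n x = x⊕d≢x x 1 1<n ∘ sym , inj₁ refl

  Adj-⊕2 : 2 < n → ∀ x → Adj n x (x ⊞ 2)
  Adj-⊕2 2<n x = x⊕d≢x x 2 2<n ∘ sym , inj₂ (inj₁ refl)

  Reach-trans : ∀ {S u v w} → Reach n S u v → Reach n S v w → Reach n S u w
  Reach-trans here               v⇝w = v⇝w
  Reach-trans (step adj w∈S u⇝v) v⇝w = step adj w∈S (Reach-trans u⇝v v⇝w)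

  star⇒¬Disconnected : ∀ {S c} → c ∈ S → (∀ {w} → w ∈ S → w ≡ c ⊎ Adj n w c) →
                       ¬ Disconnected n S
  star⇒¬Disconnected {S} {c} c∈S star (u , v , u∈S , v∈S , ¬u⇝v) =
    ¬u⇝v (Reach-trans (to-centre u∈S) (from-centre v∈S))
    where
    to-centre : ∀ {w} → w ∈ S → Reach n S w c
    to-centre w∈S with star w∈S
    ... | inj₁ refl = here
    ... | inj₂ adj  = step adj c∈S here
    from-centre : ∀ {w} → w ∈ S → Reach n S c w
    from-centre w∈S with star w∈S
    ... | inj₁ refl = here
    ... | inj₂ adj  = step (Adj-sym adj) w∈S here

  module _ {F F̃ : Subset n} {l : Fin n} (F̃∩F≡F-l : F̃ ∩ F ≡ F - l) where

    l∈∁F̃ : l ∈ F → l ∈ ∁ F̃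
    l∈∁F̃ l∈F = x∉p⇒x∈∁p λ l∈F̃ →
      x∉p-x F l (subst (l ∈_) F̃∩F≡F-l (x∈p∩q⁺ (l∈F̃ , l∈F)))

    ∈∁F̃⇒≡⊎∈∁F : ∀ {w} → w ∈ ∁ F̃ → w ≡ l ⊎ w ∈ ∁ F
    ∈∁F̃⇒≡⊎∈∁F {w} w∈∁F̃ with w ≟ l
    ... | yes w≡l = inj₁ w≡l
    ... | no  w≢l = inj₂ (x∉p⇒x∈∁p λ w∈F → x∈∁p⇒x∉p w∈∁F̃ (w∈F̃ w∈F w≢l))
      where
      w∈F̃ : w ∈ F → w ≢ l → w ∈ F̃
      w∈F̃ w∈F w≢l = proj₁ (x∈p∩q⁻ F̃ F (subst (w ∈_) (sym F̃∩F≡F-l) (x∈p∧x≢y⇒x∈p-y w∈F w≢l)))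

  module _ {F : Subset n} {l : Fin n} (∁F-adj-l : ∀ {w} → w ∈ ∁ F → Adj n w l) where

    common-neighbour∈ : l ∈ F
    common-neighbour∈ = x∉∁p⇒x∈p λ l∈∁F → proj₁ (∁F-adj-l l∈∁F) refl

    common-neighbour⇒¬IsFacet : ∀ {F̃} → F̃ ∩ F ≡ F - l → ¬ IsFacet n F̃
    common-neighbour⇒¬IsFacet {F̃} F̃∩F≡F-l (_ , ∁F̃-disconnected) =
      star⇒¬Disconnected (l∈∁F̃ F̃∩F≡F-l common-neighbour∈) star ∁F̃-disconnected
      where
      star : ∀ {w} → w ∈ ∁ F̃ → w ≡ l ⊎ Adj n w l
      star w∈∁F̃ with ∈∁F̃⇒≡⊎∈∁F F̃∩F≡F-l w∈∁F̃
      ... | inj₁ w≡l  = inj₁ w≡l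
      ... | inj₂ w∈∁F = inj₂ (∁F-adj-l w∈∁F)

    common-neighbour⇒¬Spanning : ¬ Spanning n F
    common-neighbour⇒¬Spanning spanning =
      let F̃ , (F̃-facet , _) , F̃∩F≡F-l = spanning l common-neighbour∈
      in common-neighbour⇒¬IsFacet F̃∩F≡F-l F̃-facet

  module _ (2<n : 2 < n) (x : Fin n) where

    private
      1<n : 1 < n
      1<n = <-trans (n<1+n 1) 2<n

    Adj-x⊕1-x⊕2 : Adj n (x ⊞ 1) (x ⊞ 2)
    Adj-x⊕1-x⊕2 = subst (Adj n (x ⊞ 1)) (⊕-assoc x 1 1) (Adj-⊕1 1<n (x ⊞ 1))

    Adj-x⊕3-x⊕2 : Adj n (x ⊞ 3) (x ⊞ 2)
    Adj-x⊕3-x⊕2 = subst (λ y → Adj n y (x ⊞ 2)) (⊕-assoc x 2 1) (Adj-sym (Adj-⊕1 1<n (x ⊞ 2)))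

    Adj-x⊕4-x⊕2 : Adj n (x ⊞ 4) (x ⊞ 2)
    Adj-x⊕4-x⊕2 = subst (λ y → Adj n y (x ⊞ 2)) (⊕-assoc x 2 2) (Adj-sym (Adj-⊕2 2<n (x ⊞ 2)))

    ∁F-adj-x⊕2 : ∀ {F} → (∁ F ≡ ⁅ x ⁆ ∪ ⁅ x ⊞ 1 ⁆ ∪ ⁅ x ⊞ 4 ⁆) ⊎ (∁ F ≡ ⁅ x ⁆ ∪ ⁅ x ⊞ 3 ⁆ ∪ ⁅ x ⊞ 4 ⁆) →
                 ∀ {w} → w ∈ ∁ F → Adj n w (x ⊞ 2)
    ∁F-adj-x⊕2 (inj₁ ∁F≡x,x⊕1,x⊕4) w∈∁F =
      ∈-triple-elim (Adj-⊕2 2<n x) Adj-x⊕1-x⊕2 Adj-x⊕4-x⊕2 (subst (_ ∈_) ∁F≡x,x⊕1,x⊕4 w∈∁F)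
    ∁F-adj-x⊕2 (inj₂ ∁F≡x,x⊕3,x⊕4) w∈∁F =
      ∈-triple-elim (Adj-⊕2 2<n x) Adj-x⊕3-x⊕2 Adj-x⊕4-x⊕2 (subst (_ ∈_) ∁F≡x,x⊕3,x⊕4 w∈∁F)

proposition3p14 : (n : ℕ) .{{_ : NonZero n}} → 9 ≤ n → (F : Subset n) → IsFacet n F
    → (∃ λ (x : Fin n) → (∁ F ≡ ⁅ x ⁆ ∪ ⁅ _⊕_ n x 1 ⁆ ∪ ⁅ _⊕_ n x 4 ⁆)
                        ⊎ (∁ F ≡ ⁅ x ⁆ ∪ ⁅ _⊕_ n x 3 ⁆ ∪ ⁅ _⊕_ n x 4 ⁆))
    → ¬ Spanning n F
proposition3p14 n 9≤n F _ (x , ∁F≡) =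
  common-neighbour⇒¬Spanning n (∁F-adj-x⊕2 n (≤-trans (s≤s (s≤s (s≤s z≤n))) 9≤n) x ∁F≡)
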